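{- Let $K$ be a $d$-dimensional simplicial complex and $(F,R)$ a rooted forest of $K$. Then $(F,R)$ corresponds to a gradient if and only if $F$ simplicially collapses to $R$.
   Context: A simplicial complex $K$ is a finite family of finite sets closed under subsets; $K_p$ is the set of $p$-cells (elements of size $p+1$), $K_{\le p}$ the $p$-skeleton; $K$ is $d$-dimensional if its maximal cells have dimension at most $d$. The incidence matrix $\partial_d$ has rows indexed by $K_{d-1}$, columns by $K_d$, entry $(-1)^j$ at $(r,f)$ if $f=\{v_0<\dots<v_d\}$, $r=f\setminus\{v_j\}$, and $0$ otherwise. For $F\subseteq K_d$ and $R\subseteq K_{d-1}$ with $\bar R=K_{d-1}\setminus R$, $(F,R)$ is a rooted forest of $K$ if the columns of $\partial_d$ indexed by $F$ are independent and the rows indexed by $\bar R$ of the submatrix with columns $F$ form a basis of its row space (equivalently $|\bar R|=|F|$ and the square submatrix with rows $\bar R$, columns $F$ is nonsingular). "$F$ simplicially collapses to $R$" means the subcomplex $K_{\le d-1}\cup F$ can be reduced to $K_{\le d-2}\cup R$ by a finite sequence of elementary collapses, each removing a pair $\sigma<\tau$ where $\tau$ is a $d$-cell, $\sigma$ a $(d-1)$-face of $\tau$, and $\sigma$ is a face of no other cell of the current complex. A discrete Morse function is $f:K\to\mathbb{R}$ such that each $p$-cell $\sigma$ has at most one $(p-1)$-face $\tau$ with $f(\tau)\ge f(\sigma)$ and at most one $(p+1)$-coface $\tau$ with $f(\tau)\le f(\sigma)$; $\sigma$ is critical if there are none; $c_p(f)$ counts critical $p$-cells. The gradient is $V_f=\{(\sigma,\tau):\sigma\text{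 a codimension-one face of }\tau,\ f(\tau)\le f(\sigma)\}$; $\mathcal{M}(K)$ is the set of discrete Morse functions modulo $V_f=V_g$; $\mathcal{M}_\ell(K)=\{f: c_d(f)=\ell,\ c_p(f)=|K_p|\ \forall p<d-1\}$. $(F,R)$ corresponds to a gradient if there exist $\ell$ and $f\in\mathcal{M}_\ell(K)$ such that $F$ is the set of non-critical $d$-cells of $f$ and $R$ the set of critical $(d-1)$-cells of $f$.
   Formalization: The discrete Morse functions take values in ℚ rather than ℝ. -}

module Defs where

open import Data.Nat as ℕ using (ℕ; zero; suc; _≤_; _<_)
open import Data.Nat.Properties using () renaming (_≟_ to _≟ℕ_)
open import Data.Fin using (Fin; toℕ)
open import Data.Rational as ℚ using (ℚ; 0ℚ; 1ℚ; _+_; _*_; -_)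
import Data.Rational.Properties as ℚP
open import Data.List using (List; []; _∷_; length; foldr; map; filter; removeAt; allFin)
import Data.List.Properties as LP
open import Data.List.Membership.Propositional using (_∈_; _∉_)
import Data.List.Membership.DecPropositional as DecMem
open import Data.List.Relation.Binary.Subset.Propositional using (_⊆_)
import Data.List.Relation.Binary.Subset.DecPropositional as DecSub
open import Data.List.Relation.Unary.All using (All; all?)
open import Data.List.Relation.Unary.AllPairs using (AllPairs)
open import Data.List.Relation.Unary.Unique.Propositional using (Unique)
open import Data.Product using (Σ; Σ-syntax; ∃; ∃-syntax; _×_; _,_)
open import Data.Empty using (⊥)
open import Function.Bundles using (_⇔_)
open import Relation.Nullary using (¬_; Dec; yes; no)
open import Relation.Nullary.Decidable using (_×-dec_; _→-dec_; ¬?; ⌊_⌋)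
open import Data.Bool using (if_then_else_)
open import Data.Sum using (_⊎_)
open import Relation.Binary.PropositionalEquality using (_≡_; _≢_)
open import Relation.Binary.Definitions using (DecidableEquality)
open import Relation.Binary.Construct.Closure.ReflexiveTransitive using (Star)

-- Vertices are natural numbers; a cell (finite set of vertices) is
-- represented by the strictly increasing list of its elements.
-- A cell with p+1 elements is a p-cell (the empty cell is the (-1)-cell).
Cell : Set
Cell = List ℕ

_≟c_ : DecidableEquality Cell
_≟c_ = LP.≡-dec _≟ℕ_

_∈?_ : (σ : Cell) (L : List Cell) → Dec (σ ∈ L)
_∈?_ = DecMem._∈?_ _≟c_

_⊆?_ : (τ σ : Cell) → Dec (τ ⊆ σ)
_⊆?_ = DecSub._⊆?_ _≟ℕ_

IsCell : Cell → Set
IsCell σ = AllPairs _<_ σ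

record SimplicialComplex : Set where
  field
    cells     : List Cell
    cellsOK   : All IsCell cells
    noDup     : Unique cells
    closed    : ∀ {σ τ} → σ ∈ cells → IsCell τ → τ ⊆ σ → τ ∈ cells
open SimplicialComplex public

Dimensional : SimplicialComplex → ℕ → Set
Dimensional K d = All (λ σ → length σ ≤ suc d) (cells K)

-- list of cells of K with exactly n elements (i.e. K_{n-1})
cellsOfSize : SimplicialComplex → ℕ → List Cell
cellsOfSize K n = filter (λ σ → length σ ≟ℕ n) (cells K)

IsFacet : Cell → Cell → Set
IsFacet τ σ = τ ⊆ σ × length σ ≡ suc (length τ)

isFacet? : (τ σ : Cell) → Dec (IsFacet τ σ)
isFacet? τ σ = (τ ⊆? σ) ×-dec (length σ ≟ℕ suc (length τ))

sumOver : {A : Set} → List A → (A → ℚ) → ℚ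
sumOver xs g = foldr (λ x acc → g x + acc) 0ℚ xs

sign : ℕ → ℚ
sign zero    = 1ℚ
sign (suc j) = - sign j

-- entry of the incidence matrix at row r, column f: for f = {v_0 < … < v_k},
-- it is (-1)^j if r = f ∖ {v_j}, and 0 otherwise
-- (at most one j matches since the vertices of f are distinct).
incidence : (r f : Cell) → ℚ
incidence r f =
  sumOver (allFin (length f)) (λ j → if ⌊ removeAt f j ≟c r ⌋ then sign (toℕ j) else 0ℚ)

complementRows : SimplicialComplex → ℕ → List Cell → List Cell
complementRows K d R = filter (λ r → ¬? (r ∈? R)) (cellsOfSize K d)

IsSetOfCells : SimplicialComplex → ℕ → List Cell → Set
IsSetOfCells K n X = Unique X × All (λ σ → σ ∈ cellsOfSize K n) X

ColumnsIndependent : SimplicialComplex → ℕ → List Cell → Set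
ColumnsIndependent K d F =
  ∀ (c : Cell → ℚ) →
    (∀ r → r ∈ cellsOfSize K d → sumOver F (λ f → c f * incidence r f) ≡ 0ℚ) →
    ∀ f → f ∈ F → c f ≡ 0ℚ

RowsFormBasis : SimplicialComplex → ℕ → List Cell → List Cell → Set
RowsFormBasis K d F R =
  (∀ (a : Cell → ℚ) →
     (∀ f → f ∈ F → sumOver (complementRows K d R) (λ r → a r * incidence r f) ≡ 0ℚ) →
     ∀ r → r ∈ complementRows K d R → a r ≡ 0ℚ)
  ×
  (∀ r → r ∈ cellsOfSize K d →
     Σ[ a ∈ (Cell → ℚ) ] (∀ f → f ∈ F →
       incidence r f ≡ sumOver (complementRows K d R) (λ r′ → a r′ * incidence r′ f)))

IsRootedForest : SimplicialComplex → ℕ → List Cell → List Cell → Set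
IsRootedForest K d F R =
  IsSetOfCells K (suc d) F × IsSetOfCells K d R ×
  ColumnsIndependent K d F × RowsFormBasis K d F R

IsDiscreteMorse : SimplicialComplex → (Cell → ℚ) → Set
IsDiscreteMorse K f =
  ∀ σ → σ ∈ cells K →
    (∀ τ₁ τ₂ → τ₁ ∈ cells K → τ₂ ∈ cells K →
       IsFacet τ₁ σ → f σ ℚ.≤ f τ₁ → IsFacet τ₂ σ → f σ ℚ.≤ f τ₂ → τ₁ ≡ τ₂)
    ×
    (∀ τ₁ τ₂ → τ₁ ∈ cells K → τ₂ ∈ cells K →
       IsFacet σ τ₁ → f τ₁ ℚ.≤ f σ → IsFacet σ τ₂ → f τ₂ ℚ.≤ f σ → τ₁ ≡ τ₂)

Critical : SimplicialComplex → (Cell → ℚ) → Cell → Set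
Critical K f σ =
  All (λ τ → IsFacet τ σ → ¬ (f σ ℚ.≤ f τ)) (cells K) ×
  All (λ τ → IsFacet σ τ → ¬ (f τ ℚ.≤ f σ)) (cells K)

critical? : (K : SimplicialComplex) (f : Cell → ℚ) (σ : Cell) → Dec (Critical K f σ)
critical? K f σ =
  all? (λ τ → isFacet? τ σ →-dec ¬? (f σ ℚP.≤? f τ)) (cells K) ×-dec
  all? (λ τ → isFacet? σ τ →-dec ¬? (f τ ℚP.≤? f σ)) (cells K)

criticalCount : SimplicialComplex → (Cell → ℚ) → ℕ → ℕ
criticalCount K f n = length (filter (critical? K f) (cellsOfSize K n))

-- f ∈ M_ℓ(K) for the d-dimensional complex K:
-- f is discrete Morse, c_d(f) = ℓ, and c_p(f) = |K_p| for all p < d-1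
-- (p ranges over p ≥ -1; a p-cell has p+1 = n vertices, and p < d-1 ⇔ n < d)
InM : SimplicialComplex → ℕ → ℕ → (Cell → ℚ) → Set
InM K d ℓ f =
  IsDiscreteMorse K f ×
  criticalCount K f (suc d) ≡ ℓ ×
  (∀ n → n < d → criticalCount K f n ≡ length (cellsOfSize K n))

CorrespondsToGradient : SimplicialComplex → ℕ → List Cell → List Cell → Set
CorrespondsToGradient K d F R =
  ∃[ ℓ ] ∃[ f ] (InM K d ℓ f ×
    (∀ σ → (σ ∈ F) ⇔ (σ ∈ cellsOfSize K (suc d) × ¬ Critical K f σ)) ×
    (∀ σ → (σ ∈ R) ⇔ (σ ∈ cellsOfSize K d × Critical K f σ)))

CellFamily : Set₁
CellFamily = Cell → Set

ElementaryCollapse : ℕ → CellFamily → CellFamily → Set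
ElementaryCollapse d P Q =
  ∃[ σ ] ∃[ τ ] (P τ × length τ ≡ suc d × P σ × IsFacet σ τ ×
    (∀ ρ → P ρ → σ ⊆ ρ → ρ ≡ σ ⊎ ρ ≡ τ) ×
    (∀ ρ → Q ρ ⇔ (P ρ × ρ ≢ σ × ρ ≢ τ)))

startFamily : SimplicialComplex → ℕ → List Cell → CellFamily
startFamily K d F ρ = (ρ ∈ cells K × length ρ ≤ d) ⊎ ρ ∈ F

endFamily : SimplicialComplex → ℕ → List Cell → CellFamily
endFamily K d R ρ = (ρ ∈ cells K × suc (length ρ) ≤ d) ⊎ ρ ∈ R

SimpliciallyCollapses : SimplicialComplex → ℕ → List Cell → List Cell → Set₁
SimpliciallyCollapses K d F R =
  ∃[ Q ] (Star (ElementaryCollapse d) (startFamily K d F) Q ×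
          (∀ ρ → Q ρ ⇔ endFamily K d R ρ))

-- A gradient in M_ℓ(K) leaves every cell of dimension < d-1 critical, so it matches each
-- (d-1)-cell outside R with a unique d-cell of F. Removing these pairs in order of decreasing
-- value is a simplicial collapse: when σ has the largest value among the remaining unmatched
-- cells, any remaining d-cell τ ⊇ σ is the partner of some ρ with f τ ≤ f ρ ≤ f σ, so τ is
-- the partner of σ and σ is free.
-- Conversely, from a collapse of n steps build a discrete Morse function: a cell of dimension
-- < d-1 gets its size, the pair removed at step i gets d + n - i + 1, the remaining (d-1)-cells
-- get d and the remaining d-cells a value above everything. A facet/coface pair whose values
-- are inverted must then be a removed pair, because the face of each elementary collapse was
-- free at that moment; hence the gradient consists exactly of the removed pairs.

module Submission where

open import Defs
open import Data.Nat as ℕ using (ℕ; zero; suc; _+_; _≤_; _<_; z≤n; s≤s)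
import Data.Nat.Properties as ℕP
open import Data.Rational as ℚ using (ℚ; mkℚ)
import Data.Rational.Properties as ℚP
import Data.Integer as ℤ
import Data.Integer.Properties as ℤP
import Data.Nat.Coprimality as Coprime
open import Data.List using (List; []; _∷_; length; filter; map)
import Data.List.Properties as ListP
import Data.List.Extrema
open import Data.List.Membership.Propositional using (_∈_; _∉_; find; lose)
open import Data.List.Membership.Propositional.Properties using (∈-filter⁺; ∈-filter⁻; ∈-map⁺; ∈-map⁻)
open import Data.List.Relation.Unary.Any using (here; there; any?)
open import Data.List.Relation.Unary.All as All using (All; lookup; all?)
open import Data.List.Relation.Unary.All.Properties using (¬All⇒Any¬; all-filter)
open import Data.List.Relation.Unary.AllPairs using (_∷_)
open import Data.List.Relation.Binary.Subset.Propositional using (_⊆_)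
open import Data.Product using (∃-syntax; _×_; _,_; proj₁; proj₂)
open import Data.Sum using (_⊎_; inj₁; inj₂)
open import Function using (_∘_)
open import Function.Bundles using (_⇔_; mk⇔; Equivalence)
open import Function.Construct.Composition using (_⇔-∘_)
open import Function.Construct.Identity using (⇔-id)
open import Relation.Nullary using (¬_; Dec; yes; no; contradiction)
open import Relation.Nullary.Decidable using (_×-dec_; _⊎-dec_; _→-dec_; ¬?; decidable-stable)
open import Relation.Binary.Bundles using (DecTotalOrder)
open import Relation.Binary.Definitions using (tri<; tri≈; tri>)
open import Relation.Binary.PropositionalEquality using (_≡_; _≢_; refl; sym; trans; cong; subst; subst₂)
open import Relation.Binary.Construct.Closure.ReflexiveTransitive using (Star; ε; _◅_)

open Equivalence using (to; from)

private
  ⊆-tail : ∀ {x y xs ys} → IsCell (x ∷ xs) → IsCell (y ∷ ys) →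
           x ∈ y ∷ ys → xs ⊆ y ∷ ys → xs ⊆ ys
  ⊆-tail (x<xs ∷ _) (y<ys ∷ _) x∈ xs⊆ z∈xs with xs⊆ z∈xs
  ... | there z∈ys = z∈ys
  ... | here refl with x∈
  ...   | here refl  = contradiction (lookup x<xs z∈xs) (ℕP.<-irrefl refl)
  ...   | there x∈ys = contradiction (lookup y<ys x∈ys) (ℕP.<-asym (lookup x<xs z∈xs))

  ⊆-dropHead : ∀ {x y xs ys} → IsCell (x ∷ xs) → IsCell (y ∷ ys) →
               x ∷ xs ⊆ y ∷ ys → x ∈ ys → x ∷ xs ⊆ ys
  ⊆-dropHead _  _  _   x∈ys (here refl)  = x∈ys
  ⊆-dropHead cσ cρ σ⊆ρ _    (there z∈xs) = ⊆-tail cσ cρ (σ⊆ρ (here refl)) (σ⊆ρ ∘ there) z∈xs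

length-mono-⊆ : ∀ {σ ρ} → IsCell σ → IsCell ρ → σ ⊆ ρ → length σ ≤ length ρ
length-mono-⊆ {[]}     _ _ _ = z≤n
length-mono-⊆ {_ ∷ _} {[]} _ _ σ⊆ρ with σ⊆ρ (here refl)
... | ()
length-mono-⊆ {_ ∷ _} {_ ∷ _} cσ@(_ ∷ cxs) cρ@(_ ∷ cys) σ⊆ρ with σ⊆ρ (here refl)
... | here refl  = s≤s (length-mono-⊆ cxs cys (⊆-tail cσ cρ (σ⊆ρ (here refl)) (σ⊆ρ ∘ there)))
... | there x∈ys = ℕP.m≤n⇒m≤1+n (length-mono-⊆ cσ cys (⊆-dropHead cσ cρ σ⊆ρ x∈ys))

⊆∧length≤⇒≡ : ∀ {σ ρ} → IsCell σ → IsCell ρ → σ ⊆ ρ → length ρ ≤ length σ → σ ≡ ρ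
⊆∧length≤⇒≡ {[]}    {[]}    _ _ _ _  = refl
⊆∧length≤⇒≡ {[]}    {_ ∷ _} _ _ _ ()
⊆∧length≤⇒≡ {_ ∷ _} {[]}    _ _ σ⊆ρ _ with σ⊆ρ (here refl)
... | ()
⊆∧length≤⇒≡ {x ∷ _} {_ ∷ _} cσ@(_ ∷ cxs) cρ@(_ ∷ cys) σ⊆ρ (s≤s ρ≤σ) with σ⊆ρ (here refl)
... | here refl  = cong (x ∷_) (⊆∧length≤⇒≡ cxs cys (⊆-tail cσ cρ (σ⊆ρ (here refl)) (σ⊆ρ ∘ there)) ρ≤σ)
... | there x∈ys = contradiction (ℕP.≤-trans (length-mono-⊆ cσ cys (⊆-dropHead cσ cρ σ⊆ρ x∈ys)) ρ≤σ)
                                 (ℕP.<-irrefl refl)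

facet-length : ∀ {τ σ} → IsFacet τ σ → length σ ≡ suc (length τ)
facet-length = proj₂

⋖-length⁺ : ∀ {σ τ n} → IsFacet σ τ → length σ ≡ n → length τ ≡ suc n
⋖-length⁺ σ⋖τ ∣σ∣ = trans (facet-length σ⋖τ) (cong suc ∣σ∣)

⋖-length⁻ : ∀ {σ τ n} → IsFacet σ τ → length τ ≡ suc n → length σ ≡ n
⋖-length⁻ σ⋖τ ∣τ∣ = ℕP.suc-injective (trans (sym (facet-length σ⋖τ)) ∣τ∣)

facet-irrefl : ∀ {σ} → ¬ IsFacet σ σ
facet-irrefl (_ , eq) = ℕP.1+n≢n (sym eq)

⋖-length-< : ∀ {σ τ n} → IsFacet σ τ → length τ ≤ n → length σ < n
⋖-length-< {n = n} σ⋖τ ∣τ∣≤n = subst (_≤ n) (facet-length σ⋖τ) ∣τ∣≤n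

⋖-length-≤ : ∀ {σ τ n} → IsFacet σ τ → length σ < n → length τ ≤ n
⋖-length-≤ {n = n} σ⋖τ ∣σ∣<n = subst (_≤ n) (sym (facet-length σ⋖τ)) ∣σ∣<n

no-coface-of-length : ∀ {n x τ} → length τ ≤ n → length x ≡ n → ¬ IsFacet x τ
no-coface-of-length {n} ∣τ∣≤n ∣x∣ x⋖τ = ℕP.<-irrefl refl (subst (_≤ n) (⋖-length⁺ x⋖τ ∣x∣) ∣τ∣≤n)

∈-cellsOfSize⁻ : ∀ K {n σ} → σ ∈ cellsOfSize K n → σ ∈ cells K × length σ ≡ n
∈-cellsOfSize⁻ K {n} = ∈-filter⁻ (λ σ → length σ ℕP.≟ n) {xs = cells K}

∈-cellsOfSize⁺ : ∀ K {n σ} → σ ∈ cells K → length σ ≡ n → σ ∈ cellsOfSize K n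
∈-cellsOfSize⁺ K {n} = ∈-filter⁺ (λ σ → length σ ℕP.≟ n)

criticalCount≡⇒allCritical : ∀ K f n → criticalCount K f n ≡ length (cellsOfSize K n) →
                              All (Critical K f) (cellsOfSize K n)
criticalCount≡⇒allCritical K f n eq =
  subst (All (Critical K f)) (ListP.filter-complete (critical? K f) eq)
        (all-filter (critical? K f) (cellsOfSize K n))

allCritical⇒criticalCount≡ : ∀ K f n → All (Critical K f) (cellsOfSize K n) →
                              criticalCount K f n ≡ length (cellsOfSize K n)
allCritical⇒criticalCount≡ K f n all = cong length (ListP.filter-all (critical? K f) all)

private
  counterexample : {A B : Cell → Set} → (∀ x → Dec (A x)) → (∀ x → Dec (B x)) → ∀ xs →
                   ¬ All (λ x → A x → ¬ B x) xs → ∃[ x ] (x ∈ xs × A x × B x)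
  counterexample A? B? xs ¬all with find (¬All⇒Any¬ (λ x → A? x →-dec ¬? (B? x)) xs ¬all)
  ... | x , x∈xs , ¬[A⇒¬B] =
    x , x∈xs , decidable-stable (A? x) (λ ¬a → ¬[A⇒¬B] (λ a → contradiction a ¬a))
             , decidable-stable (B? x) (λ ¬b → ¬[A⇒¬B] (λ _ → ¬b))

noncritical⇒inverted : ∀ K f {σ} → ¬ Critical K f σ →
  (∃[ τ ] (τ ∈ cells K × IsFacet τ σ × f σ ℚ.≤ f τ)) ⊎
  (∃[ τ ] (τ ∈ cells K × IsFacet σ τ × f τ ℚ.≤ f σ))
noncritical⇒inverted K f {σ} ¬crit
  with all? (λ τ → isFacet? τ σ →-dec ¬? (f σ ℚP.≤? f τ)) (cells K)
... | no ¬down = inj₁ (counterexample (λ τ → isFacet? τ σ) (λ τ → f σ ℚP.≤? f τ) (cells K) ¬down)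
... | yes down = inj₂ (counterexample (λ τ → isFacet? σ τ) (λ τ → f τ ℚP.≤? f σ) (cells K)
                                      (λ up → ¬crit (down , up)))

toℚ : ℕ → ℚ
toℚ n = mkℚ (ℤ.+ n) 0 (Coprime.sym (Coprime.1-coprimeTo n))

toℚ-cancel-≤ : ∀ {m n} → toℚ m ℚ.≤ toℚ n → m ≤ n
toℚ-cancel-≤ (ℚ.*≤* le) = ℤP.drop‿+≤+ (subst₂ ℤ._≤_ (ℤP.*-identityʳ _) (ℤP.*-identityʳ _) le)

toℚ-mono-≤ : ∀ {m n} → m ≤ n → toℚ m ℚ.≤ toℚ n
toℚ-mono-≤ le = ℚ.*≤* (subst₂ ℤ._≤_ (sym (ℤP.*-identityʳ _)) (sym (ℤP.*-identityʳ _)) (ℤ.+≤+ le))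

_≐_ : CellFamily → CellFamily → Set
P ≐ Q = ∀ ρ → P ρ ⇔ Q ρ

Collapse : ℕ → CellFamily → CellFamily → Set₁
Collapse d = Star (ElementaryCollapse d)

steps : ∀ {d P Q} → Collapse d P Q → ℕ
steps ε       = 0
steps (_ ◅ c) = suc (steps c)

module _ {d : ℕ} {P P′ : CellFamily} where

  face : ElementaryCollapse d P P′ → Cell
  face (σ , _) = σ

  coface : ElementaryCollapse d P P′ → Cell
  coface (_ , τ , _) = τ

  coface-present : (e : ElementaryCollapse d P P′) → P (coface e)
  coface-present (_ , _ , Pτ , _) = Pτ

  coface-length : (e : ElementaryCollapse d P P′) → length (coface e) ≡ suc d
  coface-length (_ , _ , _ , ∣τ∣ , _) = ∣τ∣

  face-present : (e : ElementaryCollapse d P P′) → P (face e)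
  face-present (_ , _ , _ , _ , Pσ , _) = Pσ

  face⋖coface : (e : ElementaryCollapse d P P′) → IsFacet (face e) (coface e)
  face⋖coface (_ , _ , _ , _ , _ , σ⋖τ , _) = σ⋖τ

  face-length : (e : ElementaryCollapse d P P′) → length (face e) ≡ d
  face-length e = ⋖-length⁻ (face⋖coface e) (coface-length e)

  face-free : (e : ElementaryCollapse d P P′) → ∀ ρ → P ρ → face e ⊆ ρ → ρ ≡ face e ⊎ ρ ≡ coface e
  face-free (_ , _ , _ , _ , _ , _ , free , _) = free

  after-collapse : (e : ElementaryCollapse d P P′) → P′ ≐ (λ ρ → P ρ × ρ ≢ face e × ρ ≢ coface e)
  after-collapse (_ , _ , _ , _ , _ , _ , _ , P′≐) = P′≐

elementaryCollapse-respˡ : ∀ {d P P′ Q} → P ≐ P′ → ElementaryCollapse d P′ Q → ElementaryCollapse d P Q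
elementaryCollapse-respˡ P≐P′ (σ , τ , P′τ , ∣τ∣ , P′σ , σ⋖τ , free , Q≐) =
  σ , τ , from (P≐P′ τ) P′τ , ∣τ∣ , from (P≐P′ σ) P′σ , σ⋖τ ,
  (λ ρ Pρ → free ρ (to (P≐P′ ρ) Pρ)) ,
  (λ ρ → mk⇔ (λ Qρ → let P′ρ , ρ≢σ , ρ≢τ = to (Q≐ ρ) Qρ in from (P≐P′ ρ) P′ρ , ρ≢σ , ρ≢τ)
             (λ (Pρ , ρ≢σ , ρ≢τ) → from (Q≐ ρ) (to (P≐P′ ρ) Pρ , ρ≢σ , ρ≢τ)))

collapse-respˡ : ∀ {d P P′ Q} → P ≐ P′ → Collapse d P′ Q → ∃[ Q′ ] (Collapse d P Q′ × Q′ ≐ Q)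
collapse-respˡ {P = P} P≐P′ ε       = P , ε , P≐P′
collapse-respˡ {Q = Q} P≐P′ (e ◅ c) = Q , elementaryCollapse-respˡ P≐P′ e ◅ c , λ ρ → ⇔-id (Q ρ)

collapse-⊆ : ∀ {d P Q} → Collapse d P Q → ∀ {ρ} → Q ρ → P ρ
collapse-⊆ ε       Qρ = Qρ
collapse-⊆ (e ◅ c) Qρ = proj₁ (to (after-collapse e _) (collapse-⊆ c Qρ))

-- ridge and top refer to the (d-1)-cells and the d-cells, i.e. to cells of length d and d + 1
module CollapseValues (d T : ℕ) where

  base : Cell → ℕ
  base y with length y ℕP.≟ d
  ... | yes _ = d
  ... | no  _ = T

  base-ridge : ∀ {y} → length y ≡ d → base y ≡ d
  base-ridge {y} ∣y∣ with length y ℕP.≟ d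
  ... | yes _   = refl
  ... | no  ∣y∣≢ = contradiction ∣y∣ ∣y∣≢

  base-top : ∀ {y} → length y ≡ suc d → base y ≡ T
  base-top {y} ∣y∣ with length y ℕP.≟ d
  ... | yes ∣y∣′ = contradiction (trans (sym ∣y∣) ∣y∣′) ℕP.1+n≢n
  ... | no  _    = refl

  Removes : ∀ {P P′} → ElementaryCollapse d P P′ → Cell → Set
  Removes e y = y ≡ face e ⊎ y ≡ coface e

  removes? : ∀ {P P′} (e : ElementaryCollapse d P P′) y → Dec (Removes e y)
  removes? e y = (y ≟c face e) ⊎-dec (y ≟c coface e)

  value : ∀ {P Q} → Collapse d P Q → Cell → ℕ
  value ε       y = base y
  value (e ◅ c) y with removes? e y
  ... | yes _ = d + steps (e ◅ c)
  ... | no  _ = value c y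

  value-removed : ∀ {P P′ Q} (e : ElementaryCollapse d P P′) (c : Collapse d P′ Q) {y} →
                  Removes e y → value (e ◅ c) y ≡ d + steps (e ◅ c)
  value-removed e c {y} r with removes? e y
  ... | yes _ = refl
  ... | no ¬r = contradiction r ¬r

  value-kept : ∀ {P P′ Q} (e : ElementaryCollapse d P P′) (c : Collapse d P′ Q) {y} →
               ¬ Removes e y → value (e ◅ c) y ≡ value c y
  value-kept e c {y} ¬r with removes? e y
  ... | yes r = contradiction r ¬r
  ... | no _  = refl

  present-after⇒kept : ∀ {P P′} (e : ElementaryCollapse d P P′) {y} → P′ y → ¬ Removes e y
  present-after⇒kept e P′y (inj₁ y≡σ) = proj₁ (proj₂ (to (after-collapse e _) P′y)) y≡σ
  present-after⇒kept e P′y (inj₂ y≡τ) = proj₂ (proj₂ (to (after-collapse e _) P′y)) y≡τ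

  value-range : ∀ {P Q} (c : Collapse d P Q) y →
                value c y ≡ base y ⊎ (d < value c y × value c y ≤ d + steps c)
  value-range ε       y = inj₁ refl
  value-range (e ◅ c) y with removes? e y
  ... | yes _ = inj₂ (ℕP.m<m+n d (s≤s z≤n) , ℕP.≤-refl)
  ... | no  _ with value-range c y
  ...   | inj₁ v≡base       = inj₁ v≡base
  ...   | inj₂ (d<v , v≤top) = inj₂ (d<v , ℕP.≤-trans v≤top (ℕP.+-monoʳ-≤ d (ℕP.n≤1+n _)))

  value-ridge : ∀ {P Q} (c : Collapse d P Q) {y} → length y ≡ d →
                d ≤ value c y × value c y ≤ d + steps c
  value-ridge c {y} ∣y∣ with value-range c y
  ... | inj₁ v≡base        = let v≡d = trans v≡base (base-ridge ∣y∣) in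
                             ℕP.≤-reflexive (sym v≡d) , ℕP.≤-trans (ℕP.≤-reflexive v≡d) (ℕP.m≤m+n d _)
  ... | inj₂ (d<v , v≤top) = ℕP.<⇒≤ d<v , v≤top

  value-top : ∀ {P Q} (c : Collapse d P Q) {y} → d < T → length y ≡ suc d → d < value c y
  value-top c {y} d<T ∣y∣ with value-range c y
  ... | inj₁ v≡base  = subst (d <_) (sym (trans v≡base (base-top ∣y∣))) d<T
  ... | inj₂ (d<v , _) = d<v

  value≢base⇒present : ∀ {P Q} (c : Collapse d P Q) {y} → value c y ≢ base y → P y
  value≢base⇒present ε       v≢base = contradiction refl v≢base
  value≢base⇒present (e ◅ c) {y} v≢base with removes? e y
  ... | yes (inj₁ refl) = face-present e
  ... | yes (inj₂ refl) = coface-present e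
  ... | no  _           = proj₁ (to (after-collapse e y) (value≢base⇒present c v≢base))

  top-value<T⇒present : ∀ {P Q} (c : Collapse d P Q) {y} → length y ≡ suc d → value c y < T → P y
  top-value<T⇒present c ∣y∣ v<T =
    value≢base⇒present c (λ v≡base → ℕP.<-irrefl (trans v≡base (base-top ∣y∣)) v<T)

  absent⇒value≡base : ∀ {P Q} (c : Collapse d P Q) {y} → ¬ P y → value c y ≡ base y
  absent⇒value≡base c ¬Py = decidable-stable (_ ℕP.≟ _) (¬Py ∘ value≢base⇒present c)

  survivor⇒value≡base : ∀ {P Q} (c : Collapse d P Q) {y} → Q y → value c y ≡ base y
  survivor⇒value≡base ε       _  = refl
  survivor⇒value≡base (e ◅ c) Qy =
    trans (value-kept e c (present-after⇒kept e (collapse-⊆ c Qy))) (survivor⇒value≡base c Qy)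

  removed⇒paired : ∀ {P Q} (c : Collapse d P Q) {y} → P y → ¬ Q y →
    ∃[ σ ] ∃[ τ ] (IsFacet σ τ × length τ ≡ suc d × (y ≡ σ ⊎ y ≡ τ) ×
                   value c σ ≡ value c τ × P σ × P τ)
  removed⇒paired ε       Py ¬Qy = contradiction Py ¬Qy
  removed⇒paired (e ◅ c) {y} Py ¬Qy with removes? e y
  ... | yes r  = face e , coface e , face⋖coface e , coface-length e , r ,
                 trans (value-removed e c (inj₁ refl)) (sym (value-removed e c (inj₂ refl))) ,
                 face-present e , coface-present e
  ... | no  ¬r with removed⇒paired c (from (after-collapse e y) (Py , ¬r ∘ inj₁ , ¬r ∘ inj₂)) ¬Qy
  ...   | σ , τ , σ⋖τ , ∣τ∣ , y∈στ , vσ≡vτ , P′σ , P′τ =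
          σ , τ , σ⋖τ , ∣τ∣ , y∈στ ,
          trans (value-kept e c (present-after⇒kept e P′σ))
                (trans vσ≡vτ (sym (value-kept e c (present-after⇒kept e P′τ)))) ,
          proj₁ (to (after-collapse e σ) P′σ) , proj₁ (to (after-collapse e τ) P′τ)

  module _ {P P′ Q : CellFamily} (e : ElementaryCollapse d P P′) (c : Collapse d P′ Q)
           (bound : d + steps (e ◅ c) < T) where

    bound-tail : d + steps c < T
    bound-tail = ℕP.<-trans (ℕP.+-monoʳ-< d (ℕP.n<1+n _)) bound

    -- a value below T means y was still present when the free face was removed
    free-face-coface : ∀ {y} → face e ⊆ y → length y ≡ suc d → value c y < T → y ≡ coface e
    free-face-coface {y} σ⊆y ∣y∣ v<T
      with face-free e y (proj₁ (to (after-collapse e y) (top-value<T⇒present c ∣y∣ v<T))) σ⊆y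
    ... | inj₁ refl = contradiction (trans (sym ∣y∣) (face-length e)) ℕP.1+n≢n
    ... | inj₂ y≡τ  = y≡τ

    value-kept-below : ∀ {y} → value (e ◅ c) y ≤ d + steps c → value (e ◅ c) y ≡ value c y
    value-kept-below {y} v≤ with removes? e y
    ... | yes _ = contradiction v≤ (ℕP.<⇒≱ (ℕP.+-monoʳ-< d (ℕP.n<1+n _)))
    ... | no  _ = refl

    low-coface-of-face : ∀ {y} → IsFacet (face e) y → value (e ◅ c) y ≤ d + steps (e ◅ c) →
                         y ≡ coface e
    low-coface-of-face {y} σ⋖y v≤ with removes? e y
    ... | yes (inj₁ refl) = contradiction σ⋖y facet-irrefl
    ... | yes (inj₂ refl) = refl
    ... | no  _           =
          free-face-coface (proj₁ σ⋖y) (⋖-length⁺ σ⋖y (face-length e)) (ℕP.≤-<-trans v≤ bound)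

    high-facet-of-coface : ∀ {z} → IsFacet z (coface e) → d + steps (e ◅ c) ≤ value (e ◅ c) z →
                           z ≡ face e
    high-facet-of-coface {z} z⋖τ ≤v with removes? e z
    ... | yes (inj₁ refl) = refl
    ... | yes (inj₂ refl) = contradiction z⋖τ facet-irrefl
    ... | no  _           =
          contradiction (ℕP.≤-trans ≤v (proj₂ (value-ridge c (⋖-length⁻ z⋖τ (coface-length e)))))
                        (ℕP.<⇒≱ (ℕP.+-monoʳ-< d (ℕP.n<1+n _)))

  coface-unique : ∀ {P Q} (c : Collapse d P Q) → d + steps c < T →
    ∀ {x y₁ y₂} → length x ≡ d → IsFacet x y₁ → IsFacet x y₂ →
    value c y₁ ≤ value c x → value c y₂ ≤ value c x → y₁ ≡ y₂
  coface-unique ε bound ∣x∣ x⋖y₁ _ v₁≤ _ =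
    contradiction (subst₂ _≤_ (base-top (⋖-length⁺ x⋖y₁ ∣x∣)) (base-ridge ∣x∣) v₁≤)
                  (ℕP.<⇒≱ (ℕP.≤-<-trans (ℕP.m≤m+n d 0) bound))
  coface-unique (e ◅ c) bound {x} ∣x∣ x⋖y₁ x⋖y₂ v₁≤ v₂≤ with removes? e x
  ... | yes (inj₁ refl) =
        trans (low-coface-of-face e c bound x⋖y₁ v₁≤) (sym (low-coface-of-face e c bound x⋖y₂ v₂≤))
  ... | yes (inj₂ refl) = contradiction (trans (sym (coface-length e)) ∣x∣) ℕP.1+n≢n
  ... | no  _           = coface-unique c (bound-tail e c bound) ∣x∣ x⋖y₁ x⋖y₂ (kept v₁≤) (kept v₂≤)
    where
      kept : ∀ {y} → value (e ◅ c) y ≤ value c x → value c y ≤ value c x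
      kept v≤ = subst (_≤ value c x)
                      (value-kept-below e c bound (ℕP.≤-trans v≤ (proj₂ (value-ridge c ∣x∣)))) v≤

  facet-unique : ∀ {P Q} (c : Collapse d P Q) → d + steps c < T →
    ∀ {x z₁ z₂} → length x ≡ suc d → IsFacet z₁ x → IsFacet z₂ x →
    value c x ≤ value c z₁ → value c x ≤ value c z₂ → z₁ ≡ z₂
  facet-unique ε bound ∣x∣ z₁⋖x _ ≤v₁ _ =
    contradiction (subst₂ _≤_ (base-top ∣x∣) (base-ridge (⋖-length⁻ z₁⋖x ∣x∣)) ≤v₁)
                  (ℕP.<⇒≱ (ℕP.≤-<-trans (ℕP.m≤m+n d 0) bound))
  facet-unique (e ◅ c) bound {x} ∣x∣ z₁⋖x z₂⋖x ≤v₁ ≤v₂ with removes? e x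
  ... | yes (inj₁ refl) = contradiction (trans (sym ∣x∣) (face-length e)) ℕP.1+n≢n
  ... | yes (inj₂ refl) =
        trans (high-facet-of-coface e c bound z₁⋖x ≤v₁) (sym (high-facet-of-coface e c bound z₂⋖x ≤v₂))
  ... | no  x∉στ        =
        facet-unique c (bound-tail e c bound) ∣x∣ z₁⋖x z₂⋖x (kept z₁⋖x ≤v₁) (kept z₂⋖x ≤v₂)
    where
      not-removed : ∀ {z} → IsFacet z x → value c x ≤ value (e ◅ c) z → ¬ Removes e z
      not-removed σ⋖x ≤v (inj₁ refl) =
        x∉στ (inj₂ (free-face-coface e c bound (proj₁ σ⋖x) ∣x∣
                     (ℕP.≤-<-trans (subst (value c x ≤_) (value-removed e c (inj₁ refl)) ≤v) bound)))
      not-removed τ⋖x _ (inj₂ refl) =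
        contradiction (trans (sym (⋖-length⁺ τ⋖x (coface-length e))) ∣x∣) ℕP.1+n≢n

      kept : ∀ {z} → IsFacet z x → value c x ≤ value (e ◅ c) z → value c x ≤ value c z
      kept z⋖x ≤v = subst (value c x ≤_) (value-kept e c (not-removed z⋖x ≤v)) ≤v

module CollapseToGradient
  (K : SimplicialComplex) (d : ℕ) (dim : Dimensional K d) (F R : List Cell)
  (F⊆K : ∀ {σ} → σ ∈ F → σ ∈ cellsOfSize K (suc d))
  (R⊆K : ∀ {σ} → σ ∈ R → σ ∈ cellsOfSize K d)
  {Q : CellFamily} (c : Collapse d (startFamily K d F) Q) (Q≐end : Q ≐ endFamily K d R)
  where

  T : ℕ
  T = suc (d + steps c)

  open CollapseValues d T

  bound : d + steps c < T
  bound = ℕP.≤-refl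

  g : Cell → ℕ
  g x with length x ℕ.<? d
  ... | yes _ = length x
  ... | no  _ = value c x

  f : Cell → ℚ
  f = toℚ ∘ g

  g-below : ∀ {x} → length x < d → g x ≡ length x
  g-below {x} ∣x∣<d with length x ℕ.<? d
  ... | yes _    = refl
  ... | no ∣x∣≮d = contradiction ∣x∣<d ∣x∣≮d

  g-above : ∀ {x} → d ≤ length x → g x ≡ value c x
  g-above {x} d≤∣x∣ with length x ℕ.<? d
  ... | yes ∣x∣<d = contradiction ∣x∣<d (ℕP.≤⇒≯ d≤∣x∣)
  ... | no  _     = refl

  ridge⇒d≤ : ∀ {n} → n ≡ d → d ≤ n
  ridge⇒d≤ n≡d = ℕP.≤-reflexive (sym n≡d)

  top⇒d≤ : ∀ {n} → n ≡ suc d → d ≤ n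
  top⇒d≤ n≡1+d = ℕP.≤-trans (ℕP.n≤1+n d) (ℕP.≤-reflexive (sym n≡1+d))

  g-facet-< : ∀ {z x} → IsFacet z x → length x ≤ d → g z < g x
  g-facet-< {z} {x} z⋖x ∣x∣≤d with ℕP.m≤n⇒m<n∨m≡n ∣x∣≤d
  ... | inj₁ ∣x∣<d = begin-strict
    g z            ≡⟨ g-below (⋖-length-< z⋖x ∣x∣≤d) ⟩
    length z       <⟨ ℕP.n<1+n _ ⟩
    suc (length z) ≡⟨ facet-length z⋖x ⟨
    length x       ≡⟨ g-below ∣x∣<d ⟨
    g x            ∎
    where open ℕP.≤-Reasoning
  ... | inj₂ ∣x∣≡d = begin-strict
    g z       ≡⟨ g-below (⋖-length-< z⋖x ∣x∣≤d) ⟩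
    length z  <⟨ ⋖-length-< z⋖x ∣x∣≤d ⟩
    d         ≤⟨ proj₁ (value-ridge c ∣x∣≡d) ⟩
    value c x ≡⟨ g-above (ridge⇒d≤ ∣x∣≡d) ⟨
    g x       ∎
    where open ℕP.≤-Reasoning

  g<⇒¬f≥ : ∀ {x y} → g x < g y → ¬ (f y ℚ.≤ f x)
  g<⇒¬f≥ gx<gy fy≤fx = ℕP.<⇒≱ gx<gy (toℚ-cancel-≤ fy≤fx)

  f≤⇒value≤ : ∀ {x y} → d ≤ length x → d ≤ length y → f x ℚ.≤ f y → value c x ≤ value c y
  f≤⇒value≤ d≤∣x∣ d≤∣y∣ fx≤fy = subst₂ _≤_ (g-above d≤∣x∣) (g-above d≤∣y∣) (toℚ-cancel-≤ fx≤fy)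

  inverted-facet⇒value≤ : ∀ {z x} → IsFacet z x → length x ≡ suc d → f x ℚ.≤ f z → value c x ≤ value c z
  inverted-facet⇒value≤ {z} {x} z⋖x ∣x∣ = f≤⇒value≤ {x} {z} (top⇒d≤ ∣x∣) (ridge⇒d≤ (⋖-length⁻ z⋖x ∣x∣))

  inverted-coface⇒value≤ : ∀ {x y} → IsFacet x y → length x ≡ d → f y ℚ.≤ f x → value c y ≤ value c x
  inverted-coface⇒value≤ {x} {y} x⋖y ∣x∣ = f≤⇒value≤ {y} {x} (top⇒d≤ (⋖-length⁺ x⋖y ∣x∣)) (ridge⇒d≤ ∣x∣)

  critical-by-g : ∀ {σ} →
    (∀ {τ} → τ ∈ cells K → IsFacet τ σ → g τ < g σ) →
    (∀ {τ} → τ ∈ cells K → IsFacet σ τ → g σ < g τ) → Critical K f σ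
  critical-by-g down up = All.tabulate (λ τ∈K τ⋖σ → g<⇒¬f≥ (down τ∈K τ⋖σ))
                        , All.tabulate (λ τ∈K σ⋖τ → g<⇒¬f≥ (up τ∈K σ⋖τ))

  data Layer (x : Cell) : Set where
    below : length x < d     → Layer x
    ridge : length x ≡ d     → Layer x
    top   : length x ≡ suc d → Layer x

  layer : ∀ {x} → x ∈ cells K → Layer x
  layer {x} x∈K with ℕP.<-cmp (length x) d
  ... | tri< ∣x∣<d _ _ = below ∣x∣<d
  ... | tri≈ _ ∣x∣≡d _ = ridge ∣x∣≡d
  ... | tri> _ _ ∣x∣>d = top (ℕP.≤-antisym (lookup dim x∈K) ∣x∣>d)

  below-critical : ∀ {σ} → length σ < d → Critical K f σ
  below-critical ∣σ∣<d = critical-by-g (λ _ τ⋖σ → g-facet-< τ⋖σ (ℕP.<⇒≤ ∣σ∣<d))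
                                       (λ _ σ⋖τ → g-facet-< σ⋖τ (⋖-length-≤ σ⋖τ ∣σ∣<d))

  morse : IsDiscreteMorse K f
  morse x x∈K = facets-unique , cofaces-unique
    where
      facets-unique : ∀ τ₁ τ₂ → τ₁ ∈ cells K → τ₂ ∈ cells K →
        IsFacet τ₁ x → f x ℚ.≤ f τ₁ → IsFacet τ₂ x → f x ℚ.≤ f τ₂ → τ₁ ≡ τ₂
      facets-unique _ _ _ _ τ₁⋖x fx≤ τ₂⋖x fx≤′ with layer x∈K
      ... | below ∣x∣ = contradiction fx≤ (g<⇒¬f≥ (g-facet-< τ₁⋖x (ℕP.<⇒≤ ∣x∣)))
      ... | ridge ∣x∣ = contradiction fx≤ (g<⇒¬f≥ (g-facet-< τ₁⋖x (ℕP.≤-reflexive ∣x∣)))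
      ... | top   ∣x∣ = facet-unique c bound ∣x∣ τ₁⋖x τ₂⋖x
                          (inverted-facet⇒value≤ τ₁⋖x ∣x∣ fx≤) (inverted-facet⇒value≤ τ₂⋖x ∣x∣ fx≤′)

      cofaces-unique : ∀ τ₁ τ₂ → τ₁ ∈ cells K → τ₂ ∈ cells K →
        IsFacet x τ₁ → f τ₁ ℚ.≤ f x → IsFacet x τ₂ → f τ₂ ℚ.≤ f x → τ₁ ≡ τ₂
      cofaces-unique _ _ τ₁∈K _ x⋖τ₁ fτ₁≤ x⋖τ₂ fτ₂≤ with layer x∈K
      ... | below ∣x∣ = contradiction fτ₁≤ (g<⇒¬f≥ (g-facet-< x⋖τ₁ (⋖-length-≤ x⋖τ₁ ∣x∣)))
      ... | ridge ∣x∣ = coface-unique c bound ∣x∣ x⋖τ₁ x⋖τ₂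
                          (inverted-coface⇒value≤ x⋖τ₁ ∣x∣ fτ₁≤) (inverted-coface⇒value≤ x⋖τ₂ ∣x∣ fτ₂≤)
      ... | top   ∣x∣ = contradiction x⋖τ₁ (no-coface-of-length (lookup dim τ₁∈K) ∣x∣)

  paired⇒g≡ : ∀ {σ τ} → IsFacet σ τ → length τ ≡ suc d → value c σ ≡ value c τ → g σ ≡ g τ
  paired⇒g≡ {σ} {τ} σ⋖τ ∣τ∣ vσ≡vτ =
    trans (g-above {σ} (ridge⇒d≤ (⋖-length⁻ σ⋖τ ∣τ∣))) (trans vσ≡vτ (sym (g-above {τ} (top⇒d≤ ∣τ∣))))

  start⇒cell : ∀ {ρ} → startFamily K d F ρ → ρ ∈ cells K
  start⇒cell (inj₁ (ρ∈K , _)) = ρ∈K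
  start⇒cell (inj₂ ρ∈F)       = proj₁ (∈-cellsOfSize⁻ K (F⊆K ρ∈F))

  F-length : ∀ {σ} → σ ∈ F → length σ ≡ suc d
  F-length σ∈F = proj₂ (∈-cellsOfSize⁻ K (F⊆K σ∈F))

  R-length : ∀ {σ} → σ ∈ R → length σ ≡ d
  R-length σ∈R = proj₂ (∈-cellsOfSize⁻ K (R⊆K σ∈R))

  top⇒¬Q : ∀ {σ} → length σ ≡ suc d → ¬ Q σ
  top⇒¬Q {σ} ∣σ∣ Qσ with to (Q≐end σ) Qσ
  ... | inj₁ (_ , ∣σ∣<d) = ℕP.<-asym ∣σ∣<d (subst (d <_) (sym ∣σ∣) (ℕP.n<1+n d))
  ... | inj₂ σ∈R         = ℕP.1+n≢n (trans (sym ∣σ∣) (R-length σ∈R))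

  ridge∉R⇒¬Q : ∀ {σ} → length σ ≡ d → σ ∉ R → ¬ Q σ
  ridge∉R⇒¬Q {σ} ∣σ∣ σ∉R Qσ with to (Q≐end σ) Qσ
  ... | inj₁ (_ , ∣σ∣<d) = ℕP.<-irrefl ∣σ∣ ∣σ∣<d
  ... | inj₂ σ∈R         = σ∉R σ∈R

  R⇒critical : ∀ {σ} → σ ∈ R → Critical K f σ
  R⇒critical {σ} σ∈R = critical-by-g (λ _ τ⋖σ → g-facet-< τ⋖σ (ℕP.≤-reflexive (R-length σ∈R))) up
    where
      up : ∀ {τ} → τ ∈ cells K → IsFacet σ τ → g σ < g τ
      up {τ} _ σ⋖τ = begin-strict
        g σ       ≡⟨ g-above (ridge⇒d≤ (R-length σ∈R)) ⟩
        value c σ ≡⟨ survivor⇒value≡base c (from (Q≐end σ) (inj₂ σ∈R)) ⟩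
        base σ    ≡⟨ base-ridge (R-length σ∈R) ⟩
        d         <⟨ value-top c (s≤s (ℕP.m≤m+n d _)) ∣τ∣ ⟩
        value c τ ≡⟨ g-above (top⇒d≤ ∣τ∣) ⟨
        g τ       ∎
        where open ℕP.≤-Reasoning
              ∣τ∣ = ⋖-length⁺ σ⋖τ (R-length σ∈R)

  critical⇒R : ∀ {σ} → σ ∈ cellsOfSize K d × Critical K f σ → σ ∈ R
  critical⇒R {σ} (σ∈K_d , crit) with ∈-cellsOfSize⁻ K σ∈K_d | σ ∈? R
  ... | _ , _ | yes σ∈R = σ∈R
  ... | σ∈K , ∣σ∣ | no σ∉R
    with removed⇒paired c (inj₁ (σ∈K , ℕP.≤-reflexive ∣σ∣)) (ridge∉R⇒¬Q ∣σ∣ σ∉R)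
  ...   | _ , _ , σ⋖τ , ∣τ∣ , inj₁ refl , vσ≡vτ , _ , Pτ =
          contradiction (toℚ-mono-≤ (ℕP.≤-reflexive (sym (paired⇒g≡ σ⋖τ ∣τ∣ vσ≡vτ))))
                        (lookup (proj₂ crit) (start⇒cell Pτ) σ⋖τ)
  ...   | _ , _ , _ , ∣τ∣ , inj₂ refl , _ = contradiction (trans (sym ∣τ∣) ∣σ∣) ℕP.1+n≢n

  F⇒noncritical : ∀ {σ} → σ ∈ F → ¬ Critical K f σ
  F⇒noncritical {σ} σ∈F crit with removed⇒paired c (inj₂ σ∈F) (top⇒¬Q (F-length σ∈F))
  ... | _ , _ , σ⋖τ , ∣τ∣ , inj₁ refl , _ =
          ℕP.1+n≢n (trans (sym (⋖-length⁺ σ⋖τ (F-length σ∈F))) ∣τ∣)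
  ... | _ , _ , ρ⋖σ , ∣σ∣ , inj₂ refl , vρ≡vσ , Pρ , _ =
          lookup (proj₁ crit) (start⇒cell Pρ) ρ⋖σ
                 (toℚ-mono-≤ (ℕP.≤-reflexive (sym (paired⇒g≡ ρ⋖σ ∣σ∣ vρ≡vσ))))

  noncritical⇒F : ∀ {σ} → σ ∈ cellsOfSize K (suc d) × ¬ Critical K f σ → σ ∈ F
  noncritical⇒F {σ} (σ∈K_d , ¬crit) with σ ∈? F
  ... | yes σ∈F = σ∈F
  ... | no  σ∉F = contradiction (critical-by-g down up) ¬crit
    where
      ∣σ∣ = proj₂ (∈-cellsOfSize⁻ K σ∈K_d)

      σ∉start : ¬ startFamily K d F σ
      σ∉start (inj₁ (_ , ∣σ∣≤d)) = ℕP.<⇒≱ (subst (d <_) (sym ∣σ∣) (ℕP.n<1+n d)) ∣σ∣≤d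
      σ∉start (inj₂ σ∈F)          = σ∉F σ∈F

      up : ∀ {τ} → τ ∈ cells K → IsFacet σ τ → g σ < g τ
      up τ∈K σ⋖τ = contradiction σ⋖τ (no-coface-of-length (lookup dim τ∈K) ∣σ∣)

      down : ∀ {τ} → τ ∈ cells K → IsFacet τ σ → g τ < g σ
      down {τ} _ τ⋖σ = begin-strict
        g τ       ≡⟨ g-above (ridge⇒d≤ ∣τ∣) ⟩
        value c τ <⟨ s≤s (proj₂ (value-ridge c ∣τ∣)) ⟩
        T         ≡⟨ base-top ∣σ∣ ⟨
        base σ    ≡⟨ absent⇒value≡base c σ∉start ⟨
        value c σ ≡⟨ g-above (top⇒d≤ ∣σ∣) ⟨
        g σ       ∎
        where open ℕP.≤-Reasoning
              ∣τ∣ = ⋖-length⁻ τ⋖σ ∣σ∣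

  gradient : CorrespondsToGradient K d F R
  gradient = criticalCount K f (suc d) , f , (morse , refl , below-counts) ,
             (λ σ → mk⇔ (λ σ∈F → F⊆K σ∈F , F⇒noncritical σ∈F) noncritical⇒F) ,
             (λ σ → mk⇔ (λ σ∈R → R⊆K σ∈R , R⇒critical σ∈R) critical⇒R)
    where
      below-counts : ∀ n → n < d → criticalCount K f n ≡ length (cellsOfSize K n)
      below-counts n n<d = allCritical⇒criticalCount≡ K f n (All.tabulate λ σ∈K_n →
        below-critical (subst (_< d) (sym (proj₂ (∈-cellsOfSize⁻ K σ∈K_n))) n<d))

module GradientToCollapse
  (K : SimplicialComplex) (d : ℕ) (dim : Dimensional K d) (F R : List Cell)
  (f : Cell → ℚ) (morse : IsDiscreteMorse K f)
  (below-critical : ∀ {σ} → σ ∈ cells K → length σ < d → Critical K f σ)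
  (F⇔noncritical : ∀ σ → (σ ∈ F) ⇔ (σ ∈ cellsOfSize K (suc d) × ¬ Critical K f σ))
  (R⇔critical : ∀ σ → (σ ∈ R) ⇔ (σ ∈ cellsOfSize K d × Critical K f σ))
  where

  isCell : ∀ {σ} → σ ∈ cells K → IsCell σ
  isCell = lookup (cellsOK K)

  V : Cell → Cell → Set
  V σ τ = IsFacet σ τ × f τ ℚ.≤ f σ

  V? : ∀ σ τ → Dec (V σ τ)
  V? σ τ = isFacet? σ τ ×-dec (f τ ℚP.≤? f σ)

  V-coface-unique : ∀ {σ τ₁ τ₂} → σ ∈ cells K → τ₁ ∈ cells K → τ₂ ∈ cells K →
                    V σ τ₁ → V σ τ₂ → τ₁ ≡ τ₂
  V-coface-unique σ∈K τ₁∈K τ₂∈K (σ⋖τ₁ , ≤₁) (σ⋖τ₂ , ≤₂) =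
    proj₂ (morse _ σ∈K) _ _ τ₁∈K τ₂∈K σ⋖τ₁ ≤₁ σ⋖τ₂ ≤₂

  V-face-unique : ∀ {σ₁ σ₂ τ} → τ ∈ cells K → σ₁ ∈ cells K → σ₂ ∈ cells K →
                  V σ₁ τ → V σ₂ τ → σ₁ ≡ σ₂
  V-face-unique τ∈K σ₁∈K σ₂∈K (σ₁⋖τ , ≤₁) (σ₂⋖τ , ≤₂) =
    proj₁ (morse _ τ∈K) _ _ σ₁∈K σ₂∈K σ₁⋖τ ≤₁ σ₂⋖τ ≤₂

  R-cell : ∀ {ρ} → ρ ∈ R → ρ ∈ cells K × length ρ ≡ d
  R-cell ρ∈R = ∈-cellsOfSize⁻ K (proj₁ (to (R⇔critical _) ρ∈R))

  Unmatched : List Cell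
  Unmatched = complementRows K d R

  ∈-Unmatched⁻ : ∀ {σ} → σ ∈ Unmatched → σ ∈ cells K × length σ ≡ d × σ ∉ R
  ∈-Unmatched⁻ σ∈U with ∈-filter⁻ (λ r → ¬? (r ∈? R)) {xs = cellsOfSize K d} σ∈U
  ... | σ∈K_d , σ∉R = proj₁ (∈-cellsOfSize⁻ K σ∈K_d) , proj₂ (∈-cellsOfSize⁻ K σ∈K_d) , σ∉R

  ∈-Unmatched⁺ : ∀ {σ} → σ ∈ cells K → length σ ≡ d → σ ∉ R → σ ∈ Unmatched
  ∈-Unmatched⁺ σ∈K ∣σ∣ σ∉R = ∈-filter⁺ (λ r → ¬? (r ∈? R)) (∈-cellsOfSize⁺ K σ∈K ∣σ∣) σ∉R

  -- its facets are critical, so the non-criticality of σ must come from a coface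
  Unmatched⇒V : ∀ {σ} → σ ∈ Unmatched → ∃[ τ ] (τ ∈ cells K × V σ τ)
  Unmatched⇒V {σ} σ∈U with ∈-Unmatched⁻ σ∈U
  ... | σ∈K , ∣σ∣ , σ∉R
    with noncritical⇒inverted K f (σ∉R ∘ from (R⇔critical σ) ∘ (∈-cellsOfSize⁺ K σ∈K ∣σ∣ ,_))
  ...   | inj₂ (τ , τ∈K , σ⋖τ , fτ≤fσ) = τ , τ∈K , σ⋖τ , fτ≤fσ
  ...   | inj₁ (ρ , ρ∈K , ρ⋖σ , fσ≤fρ) =
          contradiction fσ≤fρ (lookup (proj₂ (below-critical ρ∈K ∣ρ∣<d)) σ∈K ρ⋖σ)
    where ∣ρ∣<d = ℕP.≤-reflexive (trans (sym (facet-length ρ⋖σ)) ∣σ∣)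

  -- junk value σ for cells that are the face of no gradient pair
  partner : Cell → Cell
  partner σ with any? (V? σ) (cells K)
  ... | yes ∃τ = proj₁ (find ∃τ)
  ... | no  _  = σ

  partner-V : ∀ {σ} → σ ∈ Unmatched → partner σ ∈ cells K × V σ (partner σ)
  partner-V {σ} σ∈U with any? (V? σ) (cells K)
  ... | yes ∃τ = proj₂ (find ∃τ)
  ... | no  ∄τ = let τ , τ∈K , σVτ = Unmatched⇒V σ∈U in contradiction (lose τ∈K σVτ) ∄τ

  partner-length : ∀ {σ} → σ ∈ Unmatched → length (partner σ) ≡ suc d
  partner-length σ∈U = ⋖-length⁺ (proj₁ (proj₂ (partner-V σ∈U))) (proj₁ (proj₂ (∈-Unmatched⁻ σ∈U)))

  partner-injective : ∀ {σ₁ σ₂} → σ₁ ∈ Unmatched → σ₂ ∈ Unmatched → partner σ₁ ≡ partner σ₂ → σ₁ ≡ σ₂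
  partner-injective σ₁∈U σ₂∈U p₁≡p₂ =
    V-face-unique (proj₁ (partner-V σ₂∈U)) (proj₁ (∈-Unmatched⁻ σ₁∈U)) (proj₁ (∈-Unmatched⁻ σ₂∈U))
                  (subst (V _) p₁≡p₂ (proj₂ (partner-V σ₁∈U))) (proj₂ (partner-V σ₂∈U))

  partner∈F : ∀ {σ} → σ ∈ Unmatched → partner σ ∈ F
  partner∈F σ∈U with partner-V σ∈U
  ... | τ∈K , σ⋖τ , fτ≤fσ =
        from (F⇔noncritical _) (∈-cellsOfSize⁺ K τ∈K (partner-length σ∈U) ,
                                λ crit → lookup (proj₁ crit) (proj₁ (∈-Unmatched⁻ σ∈U)) σ⋖τ fτ≤fσ)

  F⇒partner : ∀ {τ} → τ ∈ F → ∃[ σ ] (σ ∈ Unmatched × τ ≡ partner σ)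
  F⇒partner {τ} τ∈F with to (F⇔noncritical τ) τ∈F
  ... | τ∈K_d , ¬crit with ∈-cellsOfSize⁻ K τ∈K_d
  ...   | τ∈K , ∣τ∣ with noncritical⇒inverted K f ¬crit
  ...     | inj₂ (_ , ρ∈K , τ⋖ρ , _) = contradiction τ⋖ρ (no-coface-of-length (lookup dim ρ∈K) ∣τ∣)
  ...     | inj₁ (σ , σ∈K , σ⋖τ , fτ≤fσ) =
            σ , σ∈U ,
            V-coface-unique σ∈K τ∈K (proj₁ (partner-V σ∈U)) (σ⋖τ , fτ≤fσ) (proj₂ (partner-V σ∈U))
    where
      σ∈U = ∈-Unmatched⁺ σ∈K (⋖-length⁻ σ⋖τ ∣τ∣)
              (λ σ∈R → lookup (proj₂ (proj₂ (to (R⇔critical σ) σ∈R))) τ∈K σ⋖τ fτ≤fσ)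

  below≢ : ∀ {ρ τ : Cell} → length ρ < d → d ≤ length τ → ρ ≢ τ
  below≢ ∣ρ∣<d d≤∣τ∣ refl = ℕP.<⇒≱ ∣ρ∣<d d≤∣τ∣

  ridge≢top : ∀ {ρ τ : Cell} → length ρ ≡ d → length τ ≡ suc d → ρ ≢ τ
  ridge≢top ∣ρ∣ ∣τ∣ refl = ℕP.1+n≢n (trans (sym ∣τ∣) ∣ρ∣)

  Remaining : List Cell → CellFamily
  Remaining L ρ = (ρ ∈ cells K × length ρ < d) ⊎ ρ ∈ R ⊎ ρ ∈ L ⊎ ρ ∈ map partner L

  _without_ : List Cell → Cell → List Cell
  L without σ = filter (λ ρ → ¬? (ρ ≟c σ)) L

  ∈-without⁻ : ∀ {L σ ρ} → ρ ∈ L without σ → ρ ∈ L × ρ ≢ σ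
  ∈-without⁻ {L} {σ} = ∈-filter⁻ (λ ρ → ¬? (ρ ≟c σ)) {xs = L}

  ∈-without⁺ : ∀ {L σ ρ} → ρ ∈ L → ρ ≢ σ → ρ ∈ L without σ
  ∈-without⁺ {σ = σ} = ∈-filter⁺ (λ ρ → ¬? (ρ ≟c σ))

  collapse-maximal : ∀ {L σ} → (∀ {ρ} → ρ ∈ L → ρ ∈ Unmatched) →
                     σ ∈ L → (∀ {ρ} → ρ ∈ L → f ρ ℚ.≤ f σ) →
                     ElementaryCollapse d (Remaining L) (Remaining (L without σ))
  collapse-maximal {L} {σ} L⊆U σ∈L σ-max =
    σ , partner σ , inj₂ (inj₂ (inj₂ (∈-map⁺ partner σ∈L))) , partner-length σ∈U ,
    inj₂ (inj₂ (inj₁ σ∈L)) , proj₁ (proj₂ (partner-V σ∈U)) , free , after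
    where
      σ∈U = L⊆U σ∈L
      σ∈K = proj₁ (∈-Unmatched⁻ σ∈U)
      ∣σ∣ = proj₁ (proj₂ (∈-Unmatched⁻ σ∈U))

      ridge-above-σ : ∀ {ρ} → ρ ∈ cells K → length ρ ≡ d → σ ⊆ ρ → ρ ≡ σ
      ridge-above-σ ρ∈K ∣ρ∣ σ⊆ρ =
        sym (⊆∧length≤⇒≡ (isCell σ∈K) (isCell ρ∈K) σ⊆ρ (ℕP.≤-reflexive (trans ∣ρ∣ (sym ∣σ∣))))

      free : ∀ ρ → Remaining L ρ → σ ⊆ ρ → ρ ≡ σ ⊎ ρ ≡ partner σ
      free ρ (inj₁ (ρ∈K , ∣ρ∣<d)) σ⊆ρ =
        contradiction (subst (_≤ length ρ) ∣σ∣ (length-mono-⊆ (isCell σ∈K) (isCell ρ∈K) σ⊆ρ))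
                      (ℕP.<⇒≱ ∣ρ∣<d)
      free ρ (inj₂ (inj₁ ρ∈R)) σ⊆ρ = inj₁ (ridge-above-σ (proj₁ (R-cell ρ∈R)) (proj₂ (R-cell ρ∈R)) σ⊆ρ)
      free ρ (inj₂ (inj₂ (inj₁ ρ∈L))) σ⊆ρ with ∈-Unmatched⁻ (L⊆U ρ∈L)
      ... | ρ∈K , ∣ρ∣ , _ = inj₁ (ridge-above-σ ρ∈K ∣ρ∣ σ⊆ρ)
      free ρ (inj₂ (inj₂ (inj₂ ρ∈pL))) σ⊆ρ with ∈-map⁻ partner ρ∈pL
      ... | τ , τ∈L , refl =
            inj₂ (V-coface-unique σ∈K (proj₁ (partner-V τ∈U)) (proj₁ (partner-V σ∈U))
                    ((σ⊆ρ , trans (partner-length τ∈U) (cong suc (sym ∣σ∣))) ,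
                     ℚP.≤-trans (proj₂ (proj₂ (partner-V τ∈U))) (σ-max τ∈L))
                    (proj₂ (partner-V σ∈U)))
        where τ∈U = L⊆U τ∈L

      after : Remaining (L without σ) ≐ (λ ρ → Remaining L ρ × ρ ≢ σ × ρ ≢ partner σ)
      after ρ = mk⇔ fw bw
        where
          fw : Remaining (L without σ) ρ → Remaining L ρ × ρ ≢ σ × ρ ≢ partner σ
          fw (inj₁ (ρ∈K , ∣ρ∣<d)) =
            inj₁ (ρ∈K , ∣ρ∣<d) , below≢ ∣ρ∣<d (ℕP.≤-reflexive (sym ∣σ∣)) ,
            below≢ ∣ρ∣<d (ℕP.≤-trans (ℕP.n≤1+n d) (ℕP.≤-reflexive (sym (partner-length σ∈U))))
          fw (inj₂ (inj₁ ρ∈R)) =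
            inj₂ (inj₁ ρ∈R) , (λ { refl → proj₂ (proj₂ (∈-Unmatched⁻ σ∈U)) ρ∈R }) ,
            ridge≢top (proj₂ (R-cell ρ∈R)) (partner-length σ∈U)
          fw (inj₂ (inj₂ (inj₁ ρ∈L∖σ))) with ∈-without⁻ ρ∈L∖σ
          ... | ρ∈L , ρ≢σ =
                inj₂ (inj₂ (inj₁ ρ∈L)) , ρ≢σ ,
                ridge≢top (proj₁ (proj₂ (∈-Unmatched⁻ (L⊆U ρ∈L)))) (partner-length σ∈U)
          fw (inj₂ (inj₂ (inj₂ ρ∈pL∖σ))) with ∈-map⁻ partner ρ∈pL∖σ
          ... | τ , τ∈L∖σ , refl with ∈-without⁻ τ∈L∖σ
          ...   | τ∈L , τ≢σ =
                  inj₂ (inj₂ (inj₂ (∈-map⁺ partner τ∈L))) ,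
                  ridge≢top ∣σ∣ (partner-length (L⊆U τ∈L)) ∘ sym ,
                  τ≢σ ∘ partner-injective (L⊆U τ∈L) σ∈U

          bw : Remaining L ρ × ρ ≢ σ × ρ ≢ partner σ → Remaining (L without σ) ρ
          bw (inj₁ below , _)                    = inj₁ below
          bw (inj₂ (inj₁ ρ∈R) , _)               = inj₂ (inj₁ ρ∈R)
          bw (inj₂ (inj₂ (inj₁ ρ∈L)) , ρ≢σ , _)  = inj₂ (inj₂ (inj₁ (∈-without⁺ ρ∈L ρ≢σ)))
          bw (inj₂ (inj₂ (inj₂ ρ∈pL)) , _ , ρ≢pσ) with ∈-map⁻ partner ρ∈pL
          ... | τ , τ∈L , refl =
                inj₂ (inj₂ (inj₂ (∈-map⁺ partner (∈-without⁺ τ∈L (ρ≢pσ ∘ cong partner)))))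

  collapse-all : ∀ n L → length L ≤ n → (∀ {ρ} → ρ ∈ L → ρ ∈ Unmatched) →
                 Collapse d (Remaining L) (Remaining [])
  collapse-all _       []      _    _   = ε
  collapse-all zero    (_ ∷ _) ()   _
  collapse-all (suc n) (ρ ∷ L) ∣L∣≤ L⊆U =
    collapse-maximal L⊆U σ∈L σ-max ◅
    collapse-all n ((ρ ∷ L) without σ) shorter (L⊆U ∘ proj₁ ∘ ∈-without⁻)
    where
      open Data.List.Extrema (DecTotalOrder.totalOrder ℚP.≤-decTotalOrder)
        using (argmax; argmax-all; f[⊥]≤f[argmax]; f[xs]≤f[argmax])

      σ : Cell
      σ = argmax f ρ L

      σ∈L : σ ∈ ρ ∷ L
      σ∈L = argmax-all f (here refl) (All.tabulate there)

      σ-max : ∀ {τ} → τ ∈ ρ ∷ L → f τ ℚ.≤ f σ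
      σ-max (here refl)  = f[⊥]≤f[argmax] {f = f} ρ L
      σ-max (there τ∈L) = lookup (f[xs]≤f[argmax] {f = f} ρ L) τ∈L

      shorter : length ((ρ ∷ L) without σ) ≤ n
      shorter = ℕP.≤-pred (ℕP.≤-trans (ListP.filter-notAll (λ τ → ¬? (τ ≟c σ)) (ρ ∷ L) σ∈L-removed) ∣L∣≤)
        where σ∈L-removed = lose σ∈L (λ σ≢σ → σ≢σ refl)

  start≐Remaining : startFamily K d F ≐ Remaining Unmatched
  start≐Remaining ρ = mk⇔ fw bw
    where
      fw : startFamily K d F ρ → Remaining Unmatched ρ
      fw (inj₁ (ρ∈K , ∣ρ∣≤d)) with ℕP.m≤n⇒m<n∨m≡n ∣ρ∣≤d
      ... | inj₁ ∣ρ∣<d = inj₁ (ρ∈K , ∣ρ∣<d)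
      ... | inj₂ ∣ρ∣≡d with ρ ∈? R
      ...   | yes ρ∈R = inj₂ (inj₁ ρ∈R)
      ...   | no  ρ∉R = inj₂ (inj₂ (inj₁ (∈-Unmatched⁺ ρ∈K ∣ρ∣≡d ρ∉R)))
      fw (inj₂ ρ∈F) with F⇒partner ρ∈F
      ... | σ , σ∈U , refl = inj₂ (inj₂ (inj₂ (∈-map⁺ partner σ∈U)))

      bw : Remaining Unmatched ρ → startFamily K d F ρ
      bw (inj₁ (ρ∈K , ∣ρ∣<d))   = inj₁ (ρ∈K , ℕP.<⇒≤ ∣ρ∣<d)
      bw (inj₂ (inj₁ ρ∈R))       = inj₁ (proj₁ (R-cell ρ∈R) , ℕP.≤-reflexive (proj₂ (R-cell ρ∈R)))
      bw (inj₂ (inj₂ (inj₁ ρ∈U))) =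
        inj₁ (proj₁ (∈-Unmatched⁻ ρ∈U) , ℕP.≤-reflexive (proj₁ (proj₂ (∈-Unmatched⁻ ρ∈U))))
      bw (inj₂ (inj₂ (inj₂ ρ∈pU))) with ∈-map⁻ partner ρ∈pU
      ... | σ , σ∈U , refl = inj₂ (partner∈F σ∈U)

  Remaining[]≐end : Remaining [] ≐ endFamily K d R
  Remaining[]≐end ρ = mk⇔ (λ { (inj₁ below) → inj₁ below ; (inj₂ (inj₁ ρ∈R)) → inj₂ ρ∈R
                             ; (inj₂ (inj₂ (inj₁ ()))) ; (inj₂ (inj₂ (inj₂ ()))) })
                          (λ { (inj₁ below) → inj₁ below ; (inj₂ ρ∈R) → inj₂ (inj₁ ρ∈R) })

  collapses : SimpliciallyCollapses K d F R
  collapses with collapse-respˡ start≐Remaining (collapse-all _ Unmatched ℕP.≤-refl (λ ρ∈U → ρ∈U))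
  ... | Q , c , Q≐ = Q , c , λ ρ → Remaining[]≐end ρ ⇔-∘ Q≐ ρ

theorem4p2 : (K : SimplicialComplex) (d : ℕ) → Dimensional K d →
    (F R : List Cell) → IsRootedForest K d F R →
    CorrespondsToGradient K d F R ⇔ SimpliciallyCollapses K d F R
theorem4p2 K d dim F R ((_ , F⊆K) , (_ , R⊆K) , _) = mk⇔ gradient⇒collapse collapse⇒gradient
  where
    gradient⇒collapse : CorrespondsToGradient K d F R → SimpliciallyCollapses K d F R
    gradient⇒collapse (_ , f , (morse , _ , below-counts) , F⇔ , R⇔) =
      GradientToCollapse.collapses K d dim F R f morse below-critical F⇔ R⇔
      where
        below-critical : ∀ {σ} → σ ∈ cells K → length σ < d → Critical K f σ
        below-critical σ∈K ∣σ∣<d =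
          lookup (criticalCount≡⇒allCritical K f _ (below-counts _ ∣σ∣<d)) (∈-cellsOfSize⁺ K σ∈K refl)

    collapse⇒gradient : SimpliciallyCollapses K d F R → CorrespondsToGradient K d F R
    collapse⇒gradient (_ , c , Q≐end) =
      CollapseToGradient.gradient K d dim F R (lookup F⊆K) (lookup R⊆K) c Q≐end
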